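{- Define the map $\Phi$ on nonzero rational functions in $z$ by $\Phi(f(z))=\frac{1}{f(1/z)}$. Then $\Phi^2=\mathrm{id}$. Moreover, for every positive integer $n$ and every $j=1,\dots,2^n$, \[ \Phi(w_{n,j})(z)=w_{n,2^n-j+1}(z). \]
   Context: Let $z$ be a variable. A positive linear fractional transformation is an expression $w=\frac{az+b}{cz+d}$ with $a,b,c,d\in\mathbb{N}_0=\{0,1,2,\dots\}$ and $ad-bc\neq0$. Define $\frac{w}{w+1}:=\frac{az+b}{(a+c)z+(b+d)}$ and $w+1:=\frac{(a+c)z+(b+d)}{cz+d}$. The rows are defined recursively. Row $0$ is $(w_{0,1})=(z)$. For $n\ge1$, row $n$ is $(w_{n,1}(z),\dots,w_{n,2^n}(z))$, with $w_{n,2i-1}=\frac{w_{n-1,i}}{w_{n-1,i}+1}$ and $w_{n,2i}=w_{n-1,i}+1$ for $i=1,\dots,2^{n-1}$. -}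

module Defs where

open import Data.Nat as ℕ using (ℕ; zero; suc; _⊔_; _∸_; _%_; _/_)
open import Data.Integer using (+_)
open import Data.Rational as ℚ using (ℚ; 0ℚ)
open import Data.List using (List; []; _∷_; _++_; map; length; reverse; replicate)
open import Data.List.Relation.Unary.Any using (Any)
open import Data.Product using (_×_; _,_)
open import Relation.Binary.PropositionalEquality using (_≡_)
open import Relation.Nullary using (¬_)

-- Polynomials in z over ℚ: coefficient lists, constant term first.

Poly : Set
Poly = List ℚ

coeff : Poly → ℕ → ℚ
coeff []       _       = 0ℚ
coeff (x ∷ p)  zero    = x
coeff (x ∷ p)  (suc k) = coeff p k

-- equality of polynomials (coefficientwise, so trailing zeros are irrelevant)
_≈ₚ_ : Poly → Poly → Set
p ≈ₚ q = ∀ k → coeff p k ≡ coeff q k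

NonZeroPoly : Poly → Set
NonZeroPoly p = Any (λ c → ¬ (c ≡ 0ℚ)) p

addP : Poly → Poly → Poly
addP []      q       = q
addP p       []      = p
addP (x ∷ p) (y ∷ q) = (x ℚ.+ y) ∷ addP p q

mulP : Poly → Poly → Poly
mulP []      q = []
mulP (x ∷ p) q = addP (map (x ℚ.*_) q) (0ℚ ∷ mulP p q)

-- Rational functions: P / Q represented as a pair (P , Q) of polynomials.
-- Nonzero rational function: both P and Q nonzero.

RatFun : Set
RatFun = Poly × Poly

NonZeroRatFun : RatFun → Set
NonZeroRatFun (P , Q) = NonZeroPoly P × NonZeroPoly Q

_≈ᵣ_ : RatFun → RatFun → Set
(P₁ , Q₁) ≈ᵣ (P₂ , Q₂) = mulP P₁ Q₂ ≈ₚ mulP P₂ Q₁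

pad : ℕ → Poly → Poly
pad N p = p ++ replicate (N ∸ length p) 0ℚ

-- Φ(f)(z) = 1 / f(1/z).  For f = P/Q and N = max(len P, len Q):
-- 1/f(1/z) = Q(1/z)/P(1/z) = (z^(N-1) Q(1/z)) / (z^(N-1) P(1/z)),
-- and z^(N-1) R(1/z) is the reversal of R padded to length N.
Φ : RatFun → RatFun
Φ (P , Q) = reverse (pad N Q) , reverse (pad N P)
  where N = length P ⊔ length Q

-- Positive linear fractional transformations (az+b)/(cz+d), a,b,c,d ∈ ℕ₀

record LFT : Set where
  constructor lft
  field a b c d : ℕ

ℕ→ℚ : ℕ → ℚ
ℕ→ℚ n = + n ℚ./ 1

toRat : LFT → RatFun
toRat (lft a b c d) = (ℕ→ℚ b ∷ ℕ→ℚ a ∷ []) , (ℕ→ℚ d ∷ ℕ→ℚ c ∷ [])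

idL : LFT
idL = lft 1 0 0 1

-- w/(w+1) := (az+b)/((a+c)z+(b+d))
leftL : LFT → LFT
leftL (lft a b c d) = lft a b (a ℕ.+ c) (b ℕ.+ d)

-- w+1 := ((a+c)z+(b+d))/(cz+d)
rightL : LFT → LFT
rightL (lft a b c d) = lft (a ℕ.+ c) (b ℕ.+ d) c d

-- zero-based rows: wz n k = w_{n,k+1}.  Index k = 2(i-1) + r with
-- r = 0 giving w_{n,2i-1} = w_{n-1,i}/(w_{n-1,i}+1) and
-- r = 1 giving w_{n,2i}   = w_{n-1,i}+1.
wz : ℕ → ℕ → LFT
wz zero    k = idL
wz (suc n) k with k % 2
... | zero  = leftL  (wz n (k / 2))
... | suc _ = rightL (wz n (k / 2))

-- one-based: w n j = w_{n,j}  (meaningful for 1 ≤ j ≤ 2^n)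
w : ℕ → ℕ → LFT
w n j = wz n (j ∸ 1)

-- Part 1.  Write f = P/Q and N = max(len P, len Q).  Φ(P, Q) pads both
-- coefficient lists to length N and reverses them; its two components then
-- have the same length, so a second application of Φ pads nothing and just
-- reverses again.  Hence Φ(Φ(P, Q)) = (pad N P, pad N Q) on the nose, and
-- padding with zeros changes neither a polynomial (coefficientwise) nor a
-- product of polynomials, which gives Φ(Φ f) ≈ᵣ f.
--
-- Part 2.  On a transformation (az+b)/(cz+d) the map Φ acts as the
-- "mirror" (dz+c)/(bz+a), and mirroring exchanges the two children
-- w/(w+1) and w+1.  Since w_{n,2i-1} and w_{n,2i} are the children of
-- w_{n-1,i}, and the mirror position of the i-th pair is the 2^(n-1)-i+1-th
-- pair with the children swapped, an induction on n shows that the entry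
-- in mirror position is the mirror of the entry; applying Φ finishes.
module Submission where

open import Defs
open import Data.Nat using (ℕ; zero; suc; _≤_; _<_; _+_; _*_; _∸_; _^_; _⊔_; _%_; _/_)
open import Data.Product using (_×_; _,_)
open import Data.Nat.Properties
  using (+-comm; n∸n≡0; m≤n+m; *-comm; m+n∸n≡m; m∸n+n≡m; *-cancelʳ-<; ≤-<-trans; ⊔-idem; m≤m⊔n; m≤n⊔m)
open import Data.Nat.DivMod using (m*n%n≡0; m*n/n≡m; [m+kn]%n≡m%n; +-distrib-/-∣ʳ)
open import Data.Nat.Divisibility using (divides-refl)
open import Data.Nat.Tactic.RingSolver using (solve-∀)
open import Data.Rational as ℚ using (0ℚ)
open import Data.Rational.Properties using (+-identityˡ; +-identityʳ; *-zeroˡ; *-zeroʳ)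
open import Data.List using ([]; _∷_; _++_; map; length; reverse; replicate)
open import Data.List.Properties using (length-++; length-replicate; length-reverse; reverse-involutive; ++-identityʳ)
open import Relation.Binary.PropositionalEquality

≈ₚ-sym : ∀ {p q} → p ≈ₚ q → q ≈ₚ p
≈ₚ-sym p≈q k = sym (p≈q k)

≈ₚ-trans : ∀ {p q r} → p ≈ₚ q → q ≈ₚ r → p ≈ₚ r
≈ₚ-trans p≈q q≈r k = trans (p≈q k) (q≈r k)

coeff-addP : ∀ p q k → coeff (addP p q) k ≡ coeff p k ℚ.+ coeff q k
coeff-addP []      q       k       = sym (+-identityˡ (coeff q k))
coeff-addP (x ∷ p) []      k       = sym (+-identityʳ (coeff (x ∷ p) k))
coeff-addP (x ∷ p) (y ∷ q) zero    = refl
coeff-addP (x ∷ p) (y ∷ q) (suc k) = coeff-addP p q k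

coeff-scale : ∀ x q k → coeff (map (x ℚ.*_) q) k ≡ x ℚ.* coeff q k
coeff-scale x []      k       = sym (*-zeroʳ x)
coeff-scale x (y ∷ q) zero    = refl
coeff-scale x (y ∷ q) (suc k) = coeff-scale x q k

∷-cong : ∀ x {p q} → p ≈ₚ q → (x ∷ p) ≈ₚ (x ∷ q)
∷-cong x p≈q zero    = refl
∷-cong x p≈q (suc k) = p≈q k

addP-cong : ∀ {p p′ q q′} → p ≈ₚ p′ → q ≈ₚ q′ → addP p q ≈ₚ addP p′ q′
addP-cong {p} {p′} {q} {q′} p≈p′ q≈q′ k = begin
  coeff (addP p q) k           ≡⟨ coeff-addP p q k ⟩
  coeff p k ℚ.+ coeff q k      ≡⟨ cong₂ ℚ._+_ (p≈p′ k) (q≈q′ k) ⟩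
  coeff p′ k ℚ.+ coeff q′ k    ≡⟨ coeff-addP p′ q′ k ⟨
  coeff (addP p′ q′) k         ∎
  where open ≡-Reasoning

scale-cong : ∀ x {q q′} → q ≈ₚ q′ → map (x ℚ.*_) q ≈ₚ map (x ℚ.*_) q′
scale-cong x {q} {q′} q≈q′ k = begin
  coeff (map (x ℚ.*_) q) k     ≡⟨ coeff-scale x q k ⟩
  x ℚ.* coeff q k              ≡⟨ cong (x ℚ.*_) (q≈q′ k) ⟩
  x ℚ.* coeff q′ k             ≡⟨ coeff-scale x q′ k ⟨
  coeff (map (x ℚ.*_) q′) k    ∎
  where open ≡-Reasoning

scale-zero : ∀ q → map (0ℚ ℚ.*_) q ≈ₚ []
scale-zero q k = trans (coeff-scale 0ℚ q k) (*-zeroˡ (coeff q k))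

mulP-congʳ : ∀ p {q q′} → q ≈ₚ q′ → mulP p q ≈ₚ mulP p q′
mulP-congʳ []      q≈q′ k = refl
mulP-congʳ (x ∷ p) {q} {q′} q≈q′ =
  addP-cong {map (x ℚ.*_) q} {map (x ℚ.*_) q′} (scale-cong x {q} {q′} q≈q′)
            (∷-cong 0ℚ (mulP-congʳ p {q} {q′} q≈q′))

mulP-zerosˡ : ∀ m q → mulP (replicate m 0ℚ) q ≈ₚ []
mulP-zerosˡ zero    q k = refl
mulP-zerosˡ (suc m) q k = begin
  coeff (addP (map (0ℚ ℚ.*_) q) (0ℚ ∷ mulP (replicate m 0ℚ) q)) k
    ≡⟨ coeff-addP (map (0ℚ ℚ.*_) q) (0ℚ ∷ mulP (replicate m 0ℚ) q) k ⟩
  coeff (map (0ℚ ℚ.*_) q) k ℚ.+ coeff (0ℚ ∷ mulP (replicate m 0ℚ) q) k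
    ≡⟨ cong₂ ℚ._+_ (scale-zero q k) (shifted k) ⟩
  0ℚ ℚ.+ 0ℚ
    ≡⟨ +-identityˡ 0ℚ ⟩
  0ℚ ∎
  where
  open ≡-Reasoning
  shifted : ∀ k → coeff (0ℚ ∷ mulP (replicate m 0ℚ) q) k ≡ 0ℚ
  shifted zero    = refl
  shifted (suc k) = mulP-zerosˡ m q k

mulP-zero-padˡ : ∀ p m q → mulP (p ++ replicate m 0ℚ) q ≈ₚ mulP p q
mulP-zero-padˡ []      m q = mulP-zerosˡ m q
mulP-zero-padˡ (x ∷ p) m q =
  addP-cong {map (x ℚ.*_) q} {map (x ℚ.*_) q} (λ k → refl) (∷-cong 0ℚ (mulP-zero-padˡ p m q))

zero-pad-≈ : ∀ p m → (p ++ replicate m 0ℚ) ≈ₚ p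
zero-pad-≈ []      zero    k       = refl
zero-pad-≈ []      (suc m) zero    = refl
zero-pad-≈ []      (suc m) (suc k) = zero-pad-≈ [] m k
zero-pad-≈ (x ∷ p) m       zero    = refl
zero-pad-≈ (x ∷ p) m       (suc k) = zero-pad-≈ p m k

length-pad : ∀ N p → length p ≤ N → length (pad N p) ≡ N
length-pad N p len≤N = begin
  length (p ++ replicate (N ∸ length p) 0ℚ)   ≡⟨ length-++ p ⟩
  length p + length (replicate (N ∸ length p) 0ℚ)
                                              ≡⟨ cong (length p +_) (length-replicate (N ∸ length p)) ⟩
  length p + (N ∸ length p)                   ≡⟨ +-comm (length p) (N ∸ length p) ⟩
  (N ∸ length p) + length p                   ≡⟨ m∸n+n≡m len≤N ⟩
  N                                           ∎
  where open ≡-Reasoning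

pad-exact : ∀ p → pad (length p) p ≡ p
pad-exact p rewrite n∸n≡0 (length p) = ++-identityʳ p

Φ-balanced : ∀ P Q → length P ≡ length Q → Φ (P , Q) ≡ (reverse Q , reverse P)
Φ-balanced P Q lenP≡lenQ = cong₂ (λ A B → reverse A , reverse B) pad-Q pad-P
  where
  N≡lenQ : length P ⊔ length Q ≡ length Q
  N≡lenQ = trans (cong (_⊔ length Q) lenP≡lenQ) (⊔-idem (length Q))
  pad-Q : pad (length P ⊔ length Q) Q ≡ Q
  pad-Q = trans (cong (λ M → pad M Q) N≡lenQ) (pad-exact Q)
  pad-P : pad (length P ⊔ length Q) P ≡ P
  pad-P = trans (cong (λ M → pad M P) (trans N≡lenQ (sym lenP≡lenQ))) (pad-exact P)

Φ-lengths : ∀ P Q → let (P′ , Q′) = Φ (P , Q) in length P′ ≡ length Q′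
Φ-lengths P Q = begin
  length (reverse (pad N Q))   ≡⟨ length-reverse (pad N Q) ⟩
  length (pad N Q)             ≡⟨ length-pad N Q (m≤n⊔m (length P) (length Q)) ⟩
  N                            ≡⟨ length-pad N P (m≤m⊔n (length P) (length Q)) ⟨
  length (pad N P)             ≡⟨ length-reverse (pad N P) ⟨
  length (reverse (pad N P))   ∎
  where
  open ≡-Reasoning
  N = length P ⊔ length Q

Φ-Φ : ∀ P Q → Φ (Φ (P , Q)) ≡ (pad (length P ⊔ length Q) P , pad (length P ⊔ length Q) Q)
Φ-Φ P Q = begin
  Φ (reverse (pad N Q) , reverse (pad N P))
    ≡⟨ Φ-balanced (reverse (pad N Q)) (reverse (pad N P)) (Φ-lengths P Q) ⟩
  (reverse (reverse (pad N P)) , reverse (reverse (pad N Q)))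
    ≡⟨ cong₂ _,_ (reverse-involutive (pad N P)) (reverse-involutive (pad N Q)) ⟩
  (pad N P , pad N Q) ∎
  where
  open ≡-Reasoning
  N = length P ⊔ length Q

Φ-involutive : ∀ f → Φ (Φ f) ≈ᵣ f
Φ-involutive (P , Q) = subst (_≈ᵣ (P , Q)) (sym (Φ-Φ P Q)) padded
  where
  N = length P ⊔ length Q
  padded : (pad N P , pad N Q) ≈ᵣ (P , Q)
  padded = ≈ₚ-trans {mulP (pad N P) Q} {mulP P Q} {mulP P (pad N Q)}
             (mulP-zero-padˡ P (N ∸ length P) Q)
             (mulP-congʳ P {Q} {pad N Q} (≈ₚ-sym {pad N Q} {Q} (zero-pad-≈ Q (N ∸ length Q))))

mirror : LFT → LFT
mirror (lft a b c d) = lft d c b a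

Φ-toRat : ∀ x → Φ (toRat x) ≡ toRat (mirror x)
Φ-toRat (lft a b c d) = refl

mirror-leftL : ∀ x → mirror (leftL x) ≡ rightL (mirror x)
mirror-leftL (lft a b c d) = cong₂ (λ u v → lft u v b a) (+-comm b d) (+-comm a c)

mirror-rightL : ∀ x → mirror (rightL x) ≡ leftL (mirror x)
mirror-rightL (lft a b c d) = cong₂ (λ u v → lft d c u v) (+-comm b d) (+-comm a c)

data Child : ℕ → Set where
  leftChild  : ∀ q → Child (q * 2)
  rightChild : ∀ q → Child (1 + q * 2)

child : ∀ k → Child k
child zero          = leftChild 0
child (suc zero)    = rightChild 0
child (suc (suc k)) with child k
... | leftChild q  = leftChild (suc q)
... | rightChild q = rightChild (suc q)

leftChild-parity : ∀ q → q * 2 % 2 ≡ 0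
leftChild-parity q = m*n%n≡0 q 2

leftChild-parent : ∀ q → q * 2 / 2 ≡ q
leftChild-parent q = m*n/n≡m q 2

rightChild-parity : ∀ q → (1 + q * 2) % 2 ≡ 1
rightChild-parity q = [m+kn]%n≡m%n 1 q 2

rightChild-parent : ∀ q → (1 + q * 2) / 2 ≡ q
rightChild-parent q = trans (+-distrib-/-∣ʳ 1 {q * 2} {2} (divides-refl q)) (m*n/n≡m q 2)

wz-leftChild : ∀ n q → wz (suc n) (q * 2) ≡ leftL (wz n q)
wz-leftChild n q rewrite leftChild-parity q | leftChild-parent q = refl

wz-rightChild : ∀ n q → wz (suc n) (1 + q * 2) ≡ rightL (wz n q)
wz-rightChild n q rewrite rightChild-parity q | rightChild-parent q = refl

mirror-index-leftChild : ∀ {P} q → q < P → 2 * P ∸ suc (q * 2) ≡ 1 + (P ∸ suc q) * 2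
mirror-index-leftChild {P} q q<P = begin
  2 * P ∸ suc (q * 2)                              ≡⟨ cong (λ t → 2 * t ∸ suc (q * 2)) (sym P≡m+1+q) ⟩
  2 * (m + suc q) ∸ suc (q * 2)                    ≡⟨ cong (_∸ suc (q * 2)) (expand m q) ⟩
  (1 + m * 2) + suc (q * 2) ∸ suc (q * 2)          ≡⟨ m+n∸n≡m (1 + m * 2) (suc (q * 2)) ⟩
  1 + m * 2                                        ∎
  where
  open ≡-Reasoning
  m = P ∸ suc q
  P≡m+1+q : m + suc q ≡ P
  P≡m+1+q = m∸n+n≡m q<P
  expand : ∀ m q → 2 * (m + suc q) ≡ (1 + m * 2) + suc (q * 2)
  expand = solve-∀

mirror-index-rightChild : ∀ {P} q → q < P → 2 * P ∸ suc (1 + q * 2) ≡ (P ∸ suc q) * 2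
mirror-index-rightChild {P} q q<P = begin
  2 * P ∸ suc (1 + q * 2)                          ≡⟨ cong (λ t → 2 * t ∸ suc (1 + q * 2)) (sym P≡m+1+q) ⟩
  2 * (m + suc q) ∸ suc (1 + q * 2)                ≡⟨ cong (_∸ suc (1 + q * 2)) (expand m q) ⟩
  m * 2 + suc (1 + q * 2) ∸ suc (1 + q * 2)        ≡⟨ m+n∸n≡m (m * 2) (suc (1 + q * 2)) ⟩
  m * 2                                            ∎
  where
  open ≡-Reasoning
  m = P ∸ suc q
  P≡m+1+q : m + suc q ≡ P
  P≡m+1+q = m∸n+n≡m q<P
  expand : ∀ m q → 2 * (m + suc q) ≡ m * 2 + suc (1 + q * 2)
  expand = solve-∀

parent-bound : ∀ {P} r q → r + q * 2 < 2 * P → q < P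
parent-bound {P} r q child<2P =
  *-cancelʳ-< 2 q P (≤-<-trans (m≤n+m (q * 2) r) (subst (r + q * 2 <_) (*-comm 2 P) child<2P))

row-mirror : ∀ n k → k < 2 ^ n → wz n (2 ^ n ∸ suc k) ≡ mirror (wz n k)
row-mirror zero    k _ = refl
row-mirror (suc n) k k<2P with child k
... | leftChild q = begin
  wz (suc n) (2 ^ suc n ∸ suc (q * 2))        ≡⟨ cong (wz (suc n)) (mirror-index-leftChild q q<P) ⟩
  wz (suc n) (1 + (2 ^ n ∸ suc q) * 2)        ≡⟨ wz-rightChild n (2 ^ n ∸ suc q) ⟩
  rightL (wz n (2 ^ n ∸ suc q))               ≡⟨ cong rightL (row-mirror n q q<P) ⟩
  rightL (mirror (wz n q))                    ≡⟨ mirror-leftL (wz n q) ⟨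
  mirror (leftL (wz n q))                     ≡⟨ cong mirror (wz-leftChild n q) ⟨
  mirror (wz (suc n) (q * 2))                 ∎
  where
  open ≡-Reasoning
  q<P : q < 2 ^ n
  q<P = parent-bound 0 q k<2P
... | rightChild q = begin
  wz (suc n) (2 ^ suc n ∸ suc (1 + q * 2))    ≡⟨ cong (wz (suc n)) (mirror-index-rightChild q q<P) ⟩
  wz (suc n) ((2 ^ n ∸ suc q) * 2)            ≡⟨ wz-leftChild n (2 ^ n ∸ suc q) ⟩
  leftL (wz n (2 ^ n ∸ suc q))                ≡⟨ cong leftL (row-mirror n q q<P) ⟩
  leftL (mirror (wz n q))                     ≡⟨ mirror-rightL (wz n q) ⟨
  mirror (rightL (wz n q))                    ≡⟨ cong mirror (wz-rightChild n q) ⟨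
  mirror (wz (suc n) (1 + q * 2))             ∎
  where
  open ≡-Reasoning
  q<P : q < 2 ^ n
  q<P = parent-bound 1 q k<2P

Φ-row-symmetry : (n j : ℕ) → 1 ≤ j → j ≤ 2 ^ n →
  Φ (toRat (w n j)) ≈ᵣ toRat (w n ((2 ^ n ∸ j) + 1))
Φ-row-symmetry n (suc k) _ j≤2ⁿ
  rewrite m+n∸n≡m (2 ^ n ∸ suc k) 1 | row-mirror n k j≤2ⁿ | Φ-toRat (wz n k) = λ i → refl

mainTheorem5 : ((f : RatFun) → NonZeroRatFun f → Φ (Φ f) ≈ᵣ f)
    × ((n j : ℕ) → 1 ≤ n → 1 ≤ j → j ≤ 2 ^ n →
    Φ (toRat (w n j)) ≈ᵣ toRat (w n ((2 ^ n ∸ j) + 1)))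
mainTheorem5 = (λ f _ → Φ-involutive f) , (λ n j _ → Φ-row-symmetry n j)
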